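{- Let \(\mathcal U\) and \(\mathcal V\) be universes. If Pataraia's-Lemma\(_{\mathcal V,\mathcal V^+\sqcup\mathcal U,\mathcal V}\) holds, then Propositional-Resizing\(_{\mathcal U,\mathcal V}\) holds.
   Context: Setting: intensional Martin-Löf type theory with universes (successor \(\mathcal V^+\), join \(\sqcup\)), function extensionality, propositional extensionality, propositional truncation; excluded middle and resizing are not assumed. A proposition is a type with at most one element. Propositional-Resizing\(_{\mathcal U,\mathcal V}\): every proposition in \(\mathcal U\) is equivalent to some type in \(\mathcal V\). A poset is a type with a proposition-valued reflexive, transitive, antisymmetric relation \(\sqsubseteq\). A \(\mathcal V\)-dcpo is a poset in which every directed family \(\alpha:I\to X\) with \(I:\mathcal V\) (\(I\) inhabited, and any \(\alpha_i,\alpha_j\) have some \(\alpha_k\) above both) has a supremum. An endomap \(f\) is inflationary if \(x\sqsubseteq f(x)\) for all \(x\); endomaps are ordered pointwise. Pataraia's-Lemma\(_{\mathcal V,\mathcal U',\mathcal T}\) asserts that every \(\mathcal V\)-dcpo whose carrier lies in universe \(\mathcal U'\) and whose order takes values in universe \(\mathcal T\) has a greatest monotone inflationary endofunction. -}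

{-# OPTIONS --without-K #-}
module Defs where

open import Level using (Level; _⊔_; Setω) renaming (suc to lsuc)
open import Data.Product using (Σ; Σ-syntax; _×_; _,_)
open import Relation.Binary.PropositionalEquality using (_≡_)
open import Function.Bundles using (_↔_)

is-prop : ∀ {ℓ} → Set ℓ → Set ℓ
is-prop X = (x y : X) → x ≡ y

Funext : Setω
Funext = ∀ {a b} {A : Set a} {B : A → Set b} {f g : (x : A) → B x}
       → ((x : A) → f x ≡ g x) → f ≡ g

Propext : Setω
Propext = ∀ {ℓ} {P Q : Set ℓ} → is-prop P → is-prop Q → (P → Q) → (Q → P) → P ≡ Q

record PropTrunc : Setω where
  field
    ∥_∥       : ∀ {ℓ} → Set ℓ → Set ℓ
    ∥∥-is-prop : ∀ {ℓ} {X : Set ℓ} → is-prop ∥ X ∥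
    ∣_∣       : ∀ {ℓ} {X : Set ℓ} → X → ∥ X ∥
    ∥∥-rec    : ∀ {ℓ ℓ'} {X : Set ℓ} {P : Set ℓ'} → is-prop P → (X → P) → ∥ X ∥ → P

Propositional-Resizing : (𝓤 𝓥 : Level) → Set (lsuc 𝓤 ⊔ lsuc 𝓥)
Propositional-Resizing 𝓤 𝓥 = (P : Set 𝓤) → is-prop P → Σ[ Q ∈ Set 𝓥 ] (P ↔ Q)

module _ (pt : PropTrunc) where
  open PropTrunc pt

  record DCPO (𝓥 𝓤' 𝓣 : Level) : Set (lsuc 𝓥 ⊔ lsuc 𝓤' ⊔ lsuc 𝓣) where
    field
      Carrier       : Set 𝓤'
      _⊑_           : Carrier → Carrier → Set 𝓣
      ⊑-prop-valued : (x y : Carrier) → is-prop (x ⊑ y)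
      ⊑-refl        : (x : Carrier) → x ⊑ x
      ⊑-trans       : (x y z : Carrier) → x ⊑ y → y ⊑ z → x ⊑ z
      ⊑-antisym     : (x y : Carrier) → x ⊑ y → y ⊑ x → x ≡ y

    is-directed : {I : Set 𝓥} → (I → Carrier) → Set (𝓥 ⊔ 𝓣)
    is-directed {I} α = ∥ I ∥
                      × ((i j : I) → ∥ Σ[ k ∈ I ] (α i ⊑ α k × α j ⊑ α k) ∥)

    is-sup : {I : Set 𝓥} → (I → Carrier) → Carrier → Set (𝓥 ⊔ 𝓤' ⊔ 𝓣)
    is-sup {I} α s = ((i : I) → α i ⊑ s)
                   × ((u : Carrier) → ((i : I) → α i ⊑ u) → s ⊑ u)

    field
      directed-complete : (I : Set 𝓥) (α : I → Carrier) → is-directed α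
                        → Σ[ s ∈ Carrier ] is-sup α s

  module _ {𝓥 𝓤' 𝓣 : Level} (D : DCPO 𝓥 𝓤' 𝓣) where
    open DCPO D

    is-monotone : (Carrier → Carrier) → Set (𝓤' ⊔ 𝓣)
    is-monotone f = (x y : Carrier) → x ⊑ y → f x ⊑ f y

    is-inflationary : (Carrier → Carrier) → Set (𝓤' ⊔ 𝓣)
    is-inflationary f = (x : Carrier) → x ⊑ f x

    is-greatest-monotone-inflationary : (Carrier → Carrier) → Set (𝓤' ⊔ 𝓣)
    is-greatest-monotone-inflationary f =
        is-monotone f × is-inflationary f
      × ((g : Carrier → Carrier) → is-monotone g → is-inflationary g
         → (x : Carrier) → g x ⊑ f x)

  Pataraias-Lemma : (𝓥 𝓤' 𝓣 : Level) → Set (lsuc 𝓥 ⊔ lsuc 𝓤' ⊔ lsuc 𝓣)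
  Pataraias-Lemma 𝓥 𝓤' 𝓣 =
    (D : DCPO 𝓥 𝓤' 𝓣) → Σ[ f ∈ (DCPO.Carrier D → DCPO.Carrier D) ]
                            is-greatest-monotone-inflationary D f

{-# OPTIONS --safe #-}
{-# OPTIONS --without-K #-}
-- Given a proposition P in 𝓤, the propositions of 𝓥 that imply P, ordered by
-- implication, form a 𝓥-dcpo whose carrier lives in 𝓥⁺ ⊔ 𝓤. If p : P, the
-- constant map at the true proposition is monotone and inflationary, so the
-- greatest such map f lies above it and every f x is inhabited. As each f x
-- also implies P, any value of f is a proposition of 𝓥 equivalent to P.
module Submission where

open import Defs
open import Level using (Level; _⊔_) renaming (suc to lsuc)
open import Data.Product using (Σ; Σ-syntax; _×_; _,_; proj₁; proj₂)
open import Data.Product.Properties using (Σ-≡,≡→≡; ×-≡,≡→≡)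
open import Data.Unit.Polymorphic using (⊤; tt)
open import Data.Empty.Polymorphic using (⊥)
open import Relation.Binary.PropositionalEquality using (_≡_; refl)
open import Axiom.UniquenessOfIdentityProofs using (module Constant⇒UIP)
open import Function.Bundles using (_↔_; mk↔ₛ′)

private
  variable
    a b : Level
    A : Set a
    B : Set b

prop-has-UIP : is-prop A → (x y : A) (p q : x ≡ y) → p ≡ q
prop-has-UIP A-prop x y =
  Constant⇒UIP.≡-irrelevant (λ {x} {y} _ → A-prop x y) (λ _ _ → refl)

is-prop-is-prop : Funext → is-prop (is-prop A)
is-prop-is-prop fe h h' = fe λ x → fe λ y → prop-has-UIP h x y (h x y) (h' x y)

×-is-prop : is-prop A → is-prop B → is-prop (A × B)
×-is-prop A-prop B-prop (x , y) (x' , y') = ×-≡,≡→≡ (A-prop x x' , B-prop y y')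

→-is-prop : Funext → is-prop B → is-prop (A → B)
→-is-prop fe B-prop f g = fe λ x → B-prop (f x) (g x)

subtype-≡ : {C : A → Set b} → ((x : A) → is-prop (C x))
          → {u v : Σ A C} → proj₁ u ≡ proj₁ v → u ≡ v
subtype-≡ C-prop {_ , c} {x , _} refl = Σ-≡,≡→≡ (refl , C-prop x _ _)

props-⇔→↔ : is-prop A → is-prop B → (A → B) → (B → A) → A ↔ B
props-⇔→↔ A-prop B-prop to from =
  mk↔ₛ′ to from (λ y → B-prop _ y) (λ x → A-prop _ x)

module PropositionsBelow (fe : Funext) (pe : Propext) (pt : PropTrunc)
                         (𝓥 : Level) {𝓤 : Level} {P : Set 𝓤} (P-prop : is-prop P) where
  open PropTrunc pt

  is-prop-below : Set 𝓥 → Set (𝓥 ⊔ 𝓤)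
  is-prop-below Q = is-prop Q × (Q → P)

  Prop-below : Set (lsuc 𝓥 ⊔ 𝓤)
  Prop-below = Σ (Set 𝓥) is-prop-below

  ⟨_⟩ : Prop-below → Set 𝓥
  ⟨_⟩ = proj₁

  ⟨⟩-is-prop : (Q : Prop-below) → is-prop ⟨ Q ⟩
  ⟨⟩-is-prop Q = proj₁ (proj₂ Q)

  ⟨⟩-implies : (Q : Prop-below) → ⟨ Q ⟩ → P
  ⟨⟩-implies Q = proj₂ (proj₂ Q)

  is-prop-below-is-prop : (Q : Set 𝓥) → is-prop (is-prop-below Q)
  is-prop-below-is-prop Q = ×-is-prop (is-prop-is-prop fe) (→-is-prop fe P-prop)

  ⊥-below : Prop-below
  ⊥-below = ⊥ , (λ ()) , (λ ())

  ⊤-below : P → Prop-below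
  ⊤-below p = ⊤ , (λ _ _ → refl) , (λ _ → p)

  ⋁ : {I : Set 𝓥} → (I → Prop-below) → Prop-below
  ⋁ {I} α = ∥ Σ[ i ∈ I ] ⟨ α i ⟩ ∥
          , ∥∥-is-prop
          , ∥∥-rec P-prop (λ (i , q) → ⟨⟩-implies (α i) q)

  -- Every family has a join, directed or not.
  props-below : DCPO pt 𝓥 (lsuc 𝓥 ⊔ 𝓤) 𝓥
  props-below = record
    { Carrier           = Prop-below
    ; _⊑_               = λ Q R → ⟨ Q ⟩ → ⟨ R ⟩
    ; ⊑-prop-valued     = λ _ R → →-is-prop fe (⟨⟩-is-prop R)
    ; ⊑-refl            = λ _ q → q
    ; ⊑-trans           = λ _ _ _ f g q → g (f q)
    ; ⊑-antisym         = λ Q R f g →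
        subtype-≡ is-prop-below-is-prop (pe (⟨⟩-is-prop Q) (⟨⟩-is-prop R) f g)
    ; directed-complete = λ I α _ →
        ⋁ α , (λ i q → ∣ i , q ∣)
            , (λ R α⊑R → ∥∥-rec (⟨⟩-is-prop R) (λ (i , q) → α⊑R i q))
    }

  greatest-monotone-inflationary-values-resize
    : (f : Prop-below → Prop-below)
    → is-greatest-monotone-inflationary pt props-below f
    → (Q : Prop-below) → P ↔ ⟨ f Q ⟩
  greatest-monotone-inflationary-values-resize f (_ , _ , f-greatest) Q =
    props-⇔→↔ P-prop (⟨⟩-is-prop (f Q)) inhabit (⟨⟩-implies (f Q))
    where
      inhabit : P → ⟨ f Q ⟩
      inhabit p = f-greatest (λ _ → ⊤-below p) (λ _ _ _ q → q) (λ _ _ → tt) Q tt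

theorem4p10 : Funext → Propext → (pt : PropTrunc) → (𝓤 𝓥 : Level)
    → Pataraias-Lemma pt 𝓥 (lsuc 𝓥 ⊔ 𝓤) 𝓥 → Propositional-Resizing 𝓤 𝓥
theorem4p10 fe pe pt 𝓤 𝓥 pataraia P P-prop =
  ⟨ f ⊥-below ⟩ , greatest-monotone-inflationary-values-resize f f-greatest ⊥-below
  where
    open PropositionsBelow fe pe pt 𝓥 P-prop
    f : Prop-below → Prop-below
    f = proj₁ (pataraia props-below)

    f-greatest : is-greatest-monotone-inflationary pt props-below f
    f-greatest = proj₂ (pataraia props-below)
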